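{- Let $\Gamma$ be a graph and let $I = \{v_1,\dots,v_k\} \subset V(\Gamma)$ be an independent vertex cut, witnessed by a partition $\{V_1, V_2, I\}$ of $V(\Gamma)$. Then $\Gamma$ admits a partial orientation as a quasi-transitive mixed graph if and only if there exist partial orientations $G_1$ of $\Gamma[V_1 \cup I]$ and $G_2$ of $\Gamma[V_2 \cup I]$ as quasi-transitive mixed graphs such that for each $1 \le i \le k$, either $v_i$ is a source in both $G_1$ and $G_2$, or $v_i$ is a sink in both $G_1$ and $G_2$.
   Context: An independent set $I \subset V(\Gamma)$ is an independent vertex cut when there is a partition $\{V_1,V_2,I\}$ of $V(\Gamma)$ such that $\Gamma - I$ is not connected, every vertex of $I$ is adjacent to at least one vertex of $V_1$ and at least one vertex of $V_2$, and no vertex of $V_1$ is adjacent to a vertex of $V_2$. A mixed graph has a vertex set, a set of (undirected) edges and a set of arcs, with at most one edge or arc between any pair of vertices. A partial orientation of a graph is a mixed graph obtained by orienting some of its edges as arcs. A $2$-dipath is a directed path $uvw$ consisting of arcs $u\to v$, $v\to w$; it is induced if $u$ and $w$ are not joined by an edge or arc. A mixed graph $H$ is quasi-transitive when (1) it has no induced $2$-dipath and (2) for every edge $uv$ there is $w$ with $uwv$ or $vwu$ a $2$-dipath. A vertex $v$ of a mixed graph is a source (resp. sink) if every arc incident with $v$ has its tail (resp. head) at $v$; incident edges are ignored. -}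

module Defs where

open import Data.Nat using (ℕ)
open import Data.Fin using (Fin)
open import Data.Product using (Σ; ∃; _×_; _,_)
open import Data.Sum using (_⊎_)
open import Relation.Nullary using (¬_)
open import Relation.Binary.PropositionalEquality using (_≡_; _≢_)

record Graph (n : ℕ) : Set₁ where
  field
    Adj   : Fin n → Fin n → Set
    sym   : ∀ {u v} → Adj u v → Adj v u
    irrefl : ∀ {u} → ¬ Adj u u
open Graph public

VSet : ℕ → Set₁
VSet n = Fin n → Set

data Walk {n : ℕ} (Γ : Graph n) (S : VSet n) : Fin n → Fin n → Set where
  here : ∀ {u} → S u → Walk Γ S u u
  step : ∀ {u v w} → S u → Adj Γ u v → Walk Γ S v w → Walk Γ S u w

Connected : {n : ℕ} → Graph n → VSet n → Set
Connected Γ S = ∀ u v → S u → S v → Walk Γ S u v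

-- The three blocks of a partition {V₁, V₂, I} of V(Γ).
data Block : Set where
  B₁ B₂ BI : Block

record IndependentVertexCut {n : ℕ} (Γ : Graph n) (part : Fin n → Block) : Set where
  field
    V₁-nonempty : ∃ λ x → part x ≡ B₁
    V₂-nonempty : ∃ λ x → part x ≡ B₂
    independent : ∀ u v → part u ≡ BI → part v ≡ BI → ¬ Adj Γ u v
    disconnected : ¬ Connected Γ (λ x → part x ≢ BI)
    nbr₁ : ∀ v → part v ≡ BI → ∃ λ u → part u ≡ B₁ × Adj Γ v u
    nbr₂ : ∀ v → part v ≡ BI → ∃ λ u → part u ≡ B₂ × Adj Γ v u
    noEdge : ∀ u v → part u ≡ B₁ → part v ≡ B₂ → ¬ Adj Γ u v

record MixedGraph (n : ℕ) : Set₁ where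
  field
    Edge : Fin n → Fin n → Set
    Arc  : Fin n → Fin n → Set
    edge-sym    : ∀ {u v} → Edge u v → Edge v u
    edge-irrefl : ∀ {u} → ¬ Edge u u
    arc-irrefl  : ∀ {u} → ¬ Arc u u
    edge-arc    : ∀ {u v} → Edge u v → ¬ Arc u v
    arc-asym    : ∀ {u v} → Arc u v → ¬ Arc v u
open MixedGraph public

Joined : {n : ℕ} → MixedGraph n → Fin n → Fin n → Set
Joined G u w = Edge G u w ⊎ Arc G u w ⊎ Arc G w u

-- G is a partial orientation of the induced subgraph Γ[S]: its vertex set is S,
-- and each edge of Γ[S] becomes exactly one edge or arc of G (and nothing else).
IsPartialOrientation : {n : ℕ} → Graph n → VSet n → MixedGraph n → Set
IsPartialOrientation Γ S G =
  ∀ u v → ((S u × S v × Adj Γ u v) → Joined G u v)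
        × (Joined G u v → (S u × S v × Adj Γ u v))

QuasiTransitive : {n : ℕ} → VSet n → MixedGraph n → Set
QuasiTransitive S G =
  -- (1) no induced 2-dipath
  (∀ u v w → S u → S v → S w → Arc G u v → Arc G v w → Joined G u w)
  ×
  -- (2) every edge lies under a 2-dipath
  (∀ u v → Edge G u v →
     ∃ λ w → S w × ((Arc G u w × Arc G w v) ⊎ (Arc G v w × Arc G w u)))

-- Sources and sinks (edges ignored).
IsSource : {n : ℕ} → MixedGraph n → Fin n → Set
IsSource G v = ∀ u → ¬ Arc G u v

IsSink : {n : ℕ} → MixedGraph n → Fin n → Set
IsSink G v = ∀ u → ¬ Arc G v u

-- A vertex v of I has neighbours in both V₁ and V₂, and quasi-transitivity
-- (property (2) when the neighbour is joined by an edge) yields arc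
-- neighbours a ∈ V₁ and c ∈ V₂. Were the arcs oriented a → v → c (or
-- backwards), property (1) would join a and c across the cut; so both point
-- out of v or both into v, and then any arc into (resp. out of) v would join
-- a vertex to both sides, forcing it into I, where it cannot be adjacent to v.
-- Hence every vertex of I is a source or a sink, and restricting a
-- quasi-transitive orientation to V₁ ∪ I and V₂ ∪ I gives G₁ and G₂; these
-- sides are closed under common neighbours of an edge, so the 2-dipaths
-- required by (2) survive. Conversely the union of G₁ and G₂ is quasi-transitive:
-- a 2-dipath switching sides passes through a vertex of I in its middle,
-- which is neither a source nor a sink.
module Submission where

open import Defs
open import Data.Nat using (ℕ)
open import Data.Fin using (Fin)
open import Data.Product using (∃; _×_; _,_; proj₁; proj₂)
open import Data.Sum using (_⊎_; inj₁; inj₂)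
open import Data.Unit using (⊤; tt)
open import Data.Empty using (⊥; ⊥-elim)
open import Function.Base using (_∘_)
open import Function.Bundles using (_⇔_; mk⇔)
open import Relation.Nullary using (¬_)
open import Relation.Binary.PropositionalEquality using (_≡_; _≢_; refl; trans; subst)
  renaming (sym to ≡-sym)

private
  variable
    n : ℕ

-- The pairs of blocks that an edge may join when I is an independent cut.
Compatible : Block → Block → Set
Compatible B₁ B₂ = ⊥
Compatible B₂ B₁ = ⊥
Compatible BI BI = ⊥
Compatible _  _  = ⊤

compatible-outside-I⇒≡ : ∀ {a c} → Compatible a c → a ≢ BI → c ≢ BI → a ≡ c
compatible-outside-I⇒≡ {B₁} {B₁} _ _ _ = refl
compatible-outside-I⇒≡ {B₂} {B₂} _ _ _ = refl
compatible-outside-I⇒≡ {BI} _ a≢I _ = ⊥-elim (a≢I refl)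
compatible-outside-I⇒≡ {_} {BI} _ _ c≢I = ⊥-elim (c≢I refl)

compatible-≢⇒BI : ∀ {a c} → Compatible a c → c ≢ BI → a ≢ c → a ≡ BI
compatible-≢⇒BI {BI} _ _ _ = refl
compatible-≢⇒BI {B₁} {B₁} _ _ a≢c = ⊥-elim (a≢c refl)
compatible-≢⇒BI {B₂} {B₂} _ _ a≢c = ⊥-elim (a≢c refl)
compatible-≢⇒BI {_} {BI} _ c≢I _ = ⊥-elim (c≢I refl)

compatible-B₁-B₂⇒BI : ∀ {a} → Compatible a B₁ → Compatible a B₂ → a ≡ BI
compatible-B₁-B₂⇒BI {BI} _ _ = refl

compatible⇒same-side : ∀ {a b} → Compatible a b →
  (a ≢ B₂ × b ≢ B₂) ⊎ (a ≢ B₁ × b ≢ B₁)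
compatible⇒same-side {B₁} {B₁} _ = inj₁ ((λ ()) , (λ ()))
compatible⇒same-side {B₁} {BI} _ = inj₁ ((λ ()) , (λ ()))
compatible⇒same-side {BI} {B₁} _ = inj₁ ((λ ()) , (λ ()))
compatible⇒same-side {B₂} {B₂} _ = inj₂ ((λ ()) , (λ ()))
compatible⇒same-side {B₂} {BI} _ = inj₂ ((λ ()) , (λ ()))
compatible⇒same-side {BI} {B₂} _ = inj₂ ((λ ()) , (λ ()))

both-sides⇒BI : ∀ {a} → a ≢ B₂ → a ≢ B₁ → a ≡ BI
both-sides⇒BI {B₁} _ a≢B₁ = ⊥-elim (a≢B₁ refl)
both-sides⇒BI {B₂} a≢B₂ _ = ⊥-elim (a≢B₂ refl)
both-sides⇒BI {BI} _ _ = refl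

module Orientation (Γ : Graph n) (S : VSet n) (G : MixedGraph n)
                   (po : IsPartialOrientation Γ S G) where

  joined⇒adj : ∀ {u v} → Joined G u v → Adj Γ u v
  joined⇒adj {u} {v} j = proj₂ (proj₂ (proj₂ (po u v) j))

  joined⇒∈ : ∀ {u v} → Joined G u v → S u × S v
  joined⇒∈ {u} {v} j = let (su , sv , _) = proj₂ (po u v) j in su , sv

  adj⇒joined : ∀ {u v} → S u → S v → Adj Γ u v → Joined G u v
  adj⇒joined {u} {v} su sv uv = proj₁ (po u v) (su , sv , uv)

  arc⇒adj : ∀ {u v} → Arc G u v → Adj Γ u v
  arc⇒adj a = joined⇒adj (inj₂ (inj₁ a))

  arc⇒adj′ : ∀ {u v} → Arc G u v → Adj Γ v u
  arc⇒adj′ a = joined⇒adj (inj₂ (inj₂ a))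

  arc⇒∈ : ∀ {u v} → Arc G u v → S u × S v
  arc⇒∈ a = joined⇒∈ (inj₂ (inj₁ a))

SourceOrSink : MixedGraph n → Fin n → Set
SourceOrSink G v = IsSource G v ⊎ IsSink G v

SourceOrSinkInBoth : MixedGraph n → MixedGraph n → Fin n → Set
SourceOrSinkInBoth G₁ G₂ v = (IsSource G₁ v × IsSource G₂ v) ⊎ (IsSink G₁ v × IsSink G₂ v)

restrict : MixedGraph n → VSet n → MixedGraph n
restrict G S = record
  { Edge        = λ u v → Edge G u v × S u × S v
  ; Arc         = λ u v → Arc G u v × S u × S v
  ; edge-sym    = λ (e , su , sv) → edge-sym G e , sv , su
  ; edge-irrefl = λ (e , _) → edge-irrefl G e
  ; arc-irrefl  = λ (a , _) → arc-irrefl G a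
  ; edge-arc    = λ (e , _) (a , _) → edge-arc G e a
  ; arc-asym    = λ (a , _) (b , _) → arc-asym G a b
  }

TriangleClosed : Graph n → VSet n → Set
TriangleClosed Γ S = ∀ {u v w} → S u → S v → Adj Γ u v → Adj Γ u w → Adj Γ v w → S w

restrict-sourceOrSink : ∀ {G : MixedGraph n} {S₁ S₂ v} →
  SourceOrSink G v → SourceOrSinkInBoth (restrict G S₁) (restrict G S₂) v
restrict-sourceOrSink (inj₁ src) = inj₁ ((λ u → src u ∘ proj₁) , (λ u → src u ∘ proj₁))
restrict-sourceOrSink (inj₂ snk) = inj₂ ((λ u → snk u ∘ proj₁) , (λ u → snk u ∘ proj₁))

module Restriction {Γ : Graph n} {G : MixedGraph n}
                   (po : IsPartialOrientation Γ (λ _ → ⊤) G) (S : VSet n) where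
  open Orientation Γ (λ _ → ⊤) G po

  restrict-joined : ∀ {u v} → S u → S v →
    Joined G u v → Joined (restrict G S) u v
  restrict-joined su sv (inj₁ e)        = inj₁ (e , su , sv)
  restrict-joined su sv (inj₂ (inj₁ a)) = inj₂ (inj₁ (a , su , sv))
  restrict-joined su sv (inj₂ (inj₂ a)) = inj₂ (inj₂ (a , sv , su))

  unrestrict-joined : ∀ {u v} →
    Joined (restrict G S) u v → Joined G u v
  unrestrict-joined (inj₁ (e , _))        = inj₁ e
  unrestrict-joined (inj₂ (inj₁ (a , _))) = inj₂ (inj₁ a)
  unrestrict-joined (inj₂ (inj₂ (a , _))) = inj₂ (inj₂ a)

  restrict-joined-∈ : ∀ {u v} →
    Joined (restrict G S) u v → S u × S v
  restrict-joined-∈ (inj₁ (_ , su , sv))        = su , sv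
  restrict-joined-∈ (inj₂ (inj₁ (_ , su , sv))) = su , sv
  restrict-joined-∈ (inj₂ (inj₂ (_ , sv , su))) = su , sv

  restrict-orientation : IsPartialOrientation Γ S (restrict G S)
  restrict-orientation u v =
      (λ (su , sv , uv) → restrict-joined su sv (adj⇒joined tt tt uv))
    , (λ j → let (su , sv) = restrict-joined-∈ j
             in su , sv , joined⇒adj (unrestrict-joined j))

  restrict-quasiTransitive : QuasiTransitive (λ _ → ⊤) G → TriangleClosed Γ S →
    QuasiTransitive S (restrict G S)
  restrict-quasiTransitive (no-dipath , edge-dipath) closed =
      (λ u v w su sv sw (uv , _) (vw , _) →
         restrict-joined su sw (no-dipath u v w tt tt tt uv vw))
    , λ u v (e , su , sv) → lift-dipath e su sv (edge-dipath u v e)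
    where
    lift-dipath : ∀ {u v} → Edge G u v → S u → S v →
      (∃ λ w → ⊤ × ((Arc G u w × Arc G w v) ⊎ (Arc G v w × Arc G w u))) →
      ∃ λ w → S w × ((Arc (restrict G S) u w × Arc (restrict G S) w v)
                   ⊎ (Arc (restrict G S) v w × Arc (restrict G S) w u))
    lift-dipath e su sv (w , _ , inj₁ (uw , wv)) =
      let sw = closed su sv (joined⇒adj (inj₁ e)) (arc⇒adj uw) (arc⇒adj′ wv)
      in w , sw , inj₁ ((uw , su , sw) , (wv , sw , sv))
    lift-dipath e su sv (w , _ , inj₂ (vw , wu)) =
      let sw = closed su sv (joined⇒adj (inj₁ e)) (arc⇒adj′ wu) (arc⇒adj vw)
      in w , sw , inj₂ ((vw , sv , sw) , (wu , sw , su))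

union : (G₁ G₂ : MixedGraph n) → (∀ {u v} → Joined G₁ u v → Joined G₂ u v → ⊥) →
  MixedGraph n
union G₁ G₂ disjoint = record
  { Edge        = λ u v → Edge G₁ u v ⊎ Edge G₂ u v
  ; Arc         = λ u v → Arc G₁ u v ⊎ Arc G₂ u v
  ; edge-sym    = λ { (inj₁ e) → inj₁ (edge-sym G₁ e) ; (inj₂ e) → inj₂ (edge-sym G₂ e) }
  ; edge-irrefl = λ { (inj₁ e) → edge-irrefl G₁ e ; (inj₂ e) → edge-irrefl G₂ e }
  ; arc-irrefl  = λ { (inj₁ a) → arc-irrefl G₁ a ; (inj₂ a) → arc-irrefl G₂ a }
  ; edge-arc    = λ { (inj₁ e) (inj₁ a) → edge-arc G₁ e a
                    ; (inj₂ e) (inj₂ a) → edge-arc G₂ e a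
                    ; (inj₁ e) (inj₂ a) → disjoint (inj₁ e) (inj₂ (inj₁ a))
                    ; (inj₂ e) (inj₁ a) → disjoint (inj₂ (inj₁ a)) (inj₁ e) }
  ; arc-asym    = λ { (inj₁ a) (inj₁ b) → arc-asym G₁ a b
                    ; (inj₂ a) (inj₂ b) → arc-asym G₂ a b
                    ; (inj₁ a) (inj₂ b) → disjoint (inj₂ (inj₁ a)) (inj₂ (inj₂ b))
                    ; (inj₂ a) (inj₁ b) → disjoint (inj₂ (inj₂ b)) (inj₂ (inj₁ a)) }
  }

module Union {Γ : Graph n} {S₁ S₂ : VSet n} {G₁ G₂ : MixedGraph n}
  (po₁ : IsPartialOrientation Γ S₁ G₁) (po₂ : IsPartialOrientation Γ S₂ G₂)
  (overlap-independent : ∀ {u v} → S₁ u → S₂ u → S₁ v → S₂ v → ¬ Adj Γ u v) where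
  private
    module O₁ = Orientation Γ S₁ G₁ po₁
    module O₂ = Orientation Γ S₂ G₂ po₂

  disjoint : ∀ {u v} → Joined G₁ u v → Joined G₂ u v → ⊥
  disjoint j₁ j₂ =
    let (s₁u , s₁v) = O₁.joined⇒∈ j₁
        (s₂u , s₂v) = O₂.joined⇒∈ j₂
    in overlap-independent s₁u s₂u s₁v s₂v (O₁.joined⇒adj j₁)

  G : MixedGraph n
  G = union G₁ G₂ disjoint

  inj₁-joined : ∀ {u v} → Joined G₁ u v → Joined G u v
  inj₁-joined (inj₁ e)        = inj₁ (inj₁ e)
  inj₁-joined (inj₂ (inj₁ a)) = inj₂ (inj₁ (inj₁ a))
  inj₁-joined (inj₂ (inj₂ a)) = inj₂ (inj₂ (inj₁ a))

  inj₂-joined : ∀ {u v} → Joined G₂ u v → Joined G u v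
  inj₂-joined (inj₁ e)        = inj₁ (inj₂ e)
  inj₂-joined (inj₂ (inj₁ a)) = inj₂ (inj₁ (inj₂ a))
  inj₂-joined (inj₂ (inj₂ a)) = inj₂ (inj₂ (inj₂ a))

  joined⇒adj-union : ∀ {u v} → Joined G u v → Adj Γ u v
  joined⇒adj-union (inj₁ (inj₁ e))        = O₁.joined⇒adj (inj₁ e)
  joined⇒adj-union (inj₁ (inj₂ e))        = O₂.joined⇒adj (inj₁ e)
  joined⇒adj-union (inj₂ (inj₁ (inj₁ a))) = O₁.arc⇒adj a
  joined⇒adj-union (inj₂ (inj₁ (inj₂ a))) = O₂.arc⇒adj a
  joined⇒adj-union (inj₂ (inj₂ (inj₁ a))) = O₁.arc⇒adj′ a
  joined⇒adj-union (inj₂ (inj₂ (inj₂ a))) = O₂.arc⇒adj′ a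

  union-orientation : (∀ {u v} → Adj Γ u v → (S₁ u × S₁ v) ⊎ (S₂ u × S₂ v)) →
    IsPartialOrientation Γ (λ _ → ⊤) G
  union-orientation cover u v = (λ (_ , _ , uv) → join uv (cover uv))
                              , (λ j → tt , tt , joined⇒adj-union j)
    where
    join : Adj Γ u v → (S₁ u × S₁ v) ⊎ (S₂ u × S₂ v) → Joined G u v
    join uv (inj₁ (su , sv)) = inj₁-joined (O₁.adj⇒joined su sv uv)
    join uv (inj₂ (su , sv)) = inj₂-joined (O₂.adj⇒joined su sv uv)

  union-quasiTransitive : QuasiTransitive S₁ G₁ → QuasiTransitive S₂ G₂ →
    (∀ {v} → S₁ v → S₂ v → SourceOrSinkInBoth G₁ G₂ v) →
    QuasiTransitive (λ _ → ⊤) G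
  union-quasiTransitive (no-dipath₁ , edge-dipath₁) (no-dipath₂ , edge-dipath₂) ends =
    no-dipath , edge-dipath
    where
    no-dipath : ∀ u v w → ⊤ → ⊤ → ⊤ → Arc G u v → Arc G v w → Joined G u w
    no-dipath u v w _ _ _ (inj₁ uv) (inj₁ vw) =
      let (su , sv) = O₁.arc⇒∈ uv
      in inj₁-joined (no-dipath₁ u v w su sv (proj₂ (O₁.arc⇒∈ vw)) uv vw)
    no-dipath u v w _ _ _ (inj₂ uv) (inj₂ vw) =
      let (su , sv) = O₂.arc⇒∈ uv
      in inj₂-joined (no-dipath₂ u v w su sv (proj₂ (O₂.arc⇒∈ vw)) uv vw)
    no-dipath u v w _ _ _ (inj₁ uv) (inj₂ vw)
      with ends (proj₂ (O₁.arc⇒∈ uv)) (proj₁ (O₂.arc⇒∈ vw))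
    ... | inj₁ (src₁ , _) = ⊥-elim (src₁ u uv)
    ... | inj₂ (_ , snk₂) = ⊥-elim (snk₂ w vw)
    no-dipath u v w _ _ _ (inj₂ uv) (inj₁ vw)
      with ends (proj₁ (O₁.arc⇒∈ vw)) (proj₂ (O₂.arc⇒∈ uv))
    ... | inj₁ (_ , src₂) = ⊥-elim (src₂ u uv)
    ... | inj₂ (snk₁ , _) = ⊥-elim (snk₁ w vw)

    edge-dipath : ∀ u v → Edge G u v →
      ∃ λ w → ⊤ × ((Arc G u w × Arc G w v) ⊎ (Arc G v w × Arc G w u))
    edge-dipath u v (inj₁ e) with edge-dipath₁ u v e
    ... | w , _ , inj₁ (uw , wv) = w , tt , inj₁ (inj₁ uw , inj₁ wv)
    ... | w , _ , inj₂ (vw , wu) = w , tt , inj₂ (inj₁ vw , inj₁ wu)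
    edge-dipath u v (inj₂ e) with edge-dipath₂ u v e
    ... | w , _ , inj₁ (uw , wv) = w , tt , inj₁ (inj₂ uw , inj₂ wv)
    ... | w , _ , inj₂ (vw , wu) = w , tt , inj₂ (inj₂ vw , inj₂ wu)

module Cut {Γ : Graph n} {part : Fin n → Block} (cut : IndependentVertexCut Γ part) where
  open IndependentVertexCut cut

  adj-compatible : ∀ {u v} → Adj Γ u v → Compatible (part u) (part v)
  adj-compatible {u} {v} uv with part u in eu | part v in ev
  ... | B₁ | B₁ = tt
  ... | B₁ | B₂ = noEdge u v eu ev uv
  ... | B₁ | BI = tt
  ... | B₂ | B₁ = noEdge v u ev eu (sym Γ uv)
  ... | B₂ | B₂ = tt
  ... | B₂ | BI = tt
  ... | BI | B₁ = tt
  ... | BI | B₂ = tt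
  ... | BI | BI = independent u v eu ev uv

  both-sides-independent : ∀ {u v} → part u ≢ B₂ → part u ≢ B₁ →
    part v ≢ B₂ → part v ≢ B₁ → ¬ Adj Γ u v
  both-sides-independent u₁ u₂ v₁ v₂ =
    independent _ _ (both-sides⇒BI u₁ u₂) (both-sides⇒BI v₁ v₂)

  adj⇒same-side : ∀ {u v} → Adj Γ u v →
    (part u ≢ B₂ × part v ≢ B₂) ⊎ (part u ≢ B₁ × part v ≢ B₁)
  adj⇒same-side uv = compatible⇒same-side (adj-compatible uv)

  side-triangleClosed : ∀ b → b ≢ BI → TriangleClosed Γ (λ x → part x ≢ b)
  side-triangleClosed b b≢I {u} {v} {w} u∉b v∉b uv uw vw w∈b =
    independent u v (in-I u∉b uw) (in-I v∉b vw) uv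
    where
    in-I : ∀ {x} → part x ≢ b → Adj Γ x w → part x ≡ BI
    in-I x∉b xw = compatible-≢⇒BI (adj-compatible xw)
      (λ wI → b≢I (trans (≡-sym w∈b) wI)) (λ x≡w → x∉b (trans x≡w w∈b))

  common-neighbour-in-block : ∀ {v z w b} → part v ≡ BI → part z ≡ b → b ≢ BI →
    Adj Γ w z → Adj Γ w v → part w ≡ b
  common-neighbour-in-block {v} {z} {w} vI z∈b b≢I wz wv =
    trans (compatible-outside-I⇒≡ (adj-compatible wz)
             (λ wI → independent w v wI vI wv) (λ zI → b≢I (trans (≡-sym z∈b) zI)))
          z∈b

  adjacent-to-both-sides⇒∈I : ∀ {x a c} → part a ≡ B₁ → part c ≡ B₂ →
    Adj Γ x a → Adj Γ x c → part x ≡ BI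
  adjacent-to-both-sides⇒∈I {x} a∈V₁ c∈V₂ xa xc = compatible-B₁-B₂⇒BI
    (subst (Compatible (part x)) a∈V₁ (adj-compatible xa))
    (subst (Compatible (part x)) c∈V₂ (adj-compatible xc))

  module _ {G : MixedGraph n} (po : IsPartialOrientation Γ (λ _ → ⊤) G)
           (qt : QuasiTransitive (λ _ → ⊤) G) where
    open Orientation Γ (λ _ → ⊤) G po

    dipath⇒adj : ∀ {x y w} → Arc G x y → Arc G y w → Adj Γ x w
    dipath⇒adj xy yw = joined⇒adj (proj₁ qt _ _ _ tt tt tt xy yw)

    arc-neighbour : ∀ {v z b} → part v ≡ BI → part z ≡ b → b ≢ BI → Adj Γ v z →
      ∃ λ w → part w ≡ b × (Arc G v w ⊎ Arc G w v)
    arc-neighbour {v} {z} {b} vI z∈b b≢I vz with adj⇒joined tt tt vz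
    ... | inj₂ (inj₁ a) = z , z∈b , inj₁ a
    ... | inj₂ (inj₂ a) = z , z∈b , inj₂ a
    ... | inj₁ e with proj₂ qt v z e
    ...   | w , _ , inj₁ (vw , wz) =
      w , common-neighbour-in-block vI z∈b b≢I (arc⇒adj wz) (arc⇒adj′ vw) , inj₁ vw
    ...   | w , _ , inj₂ (zw , wv) =
      w , common-neighbour-in-block vI z∈b b≢I (arc⇒adj′ zw) (arc⇒adj wv) , inj₂ wv

    cut-vertex-sourceOrSink : ∀ {v} → part v ≡ BI → SourceOrSink G v
    cut-vertex-sourceOrSink {v} vI
      with nbr₁ v vI | nbr₂ v vI
    ... | _ , y∈V₁ , vy | _ , z∈V₂ , vz
      with arc-neighbour vI y∈V₁ (λ ()) vy | arc-neighbour vI z∈V₂ (λ ()) vz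
    ... | a , a∈V₁ , inj₁ va | c , c∈V₂ , inj₁ vc =
      inj₁ λ x xv → independent x v
        (adjacent-to-both-sides⇒∈I a∈V₁ c∈V₂ (dipath⇒adj xv va) (dipath⇒adj xv vc))
        vI (arc⇒adj xv)
    ... | a , a∈V₁ , inj₂ av | c , c∈V₂ , inj₂ cv =
      inj₂ λ x vx → independent x v
        (adjacent-to-both-sides⇒∈I a∈V₁ c∈V₂
          (sym Γ (dipath⇒adj av vx)) (sym Γ (dipath⇒adj cv vx)))
        vI (arc⇒adj′ vx)
    ... | a , a∈V₁ , inj₁ va | c , c∈V₂ , inj₂ cv =
      ⊥-elim (noEdge a c a∈V₁ c∈V₂ (sym Γ (dipath⇒adj cv va)))
    ... | a , a∈V₁ , inj₂ av | c , c∈V₂ , inj₁ vc =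
      ⊥-elim (noEdge a c a∈V₁ c∈V₂ (dipath⇒adj av vc))

lemma2p4 : {n : ℕ} (Γ : Graph n) (part : Fin n → Block) →
    IndependentVertexCut Γ part →
    (∃ λ (G : MixedGraph n) →
        IsPartialOrientation Γ (λ _ → ⊤) G × QuasiTransitive (λ _ → ⊤) G)
    ⇔
    (∃ λ (G₁ : MixedGraph n) → ∃ λ (G₂ : MixedGraph n) →
        IsPartialOrientation Γ (λ x → part x ≢ B₂) G₁ × QuasiTransitive (λ x → part x ≢ B₂) G₁ ×
        IsPartialOrientation Γ (λ x → part x ≢ B₁) G₂ × QuasiTransitive (λ x → part x ≢ B₁) G₂ ×
        (∀ v → part v ≡ BI →
          (IsSource G₁ v × IsSource G₂ v) ⊎ (IsSink G₁ v × IsSink G₂ v)))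
lemma2p4 Γ part cut = mk⇔
  (λ (G , po , qt) →
     let module R₁ = Restriction {Γ = Γ} {G = G} po V₁∪I
         module R₂ = Restriction {Γ = Γ} {G = G} po V₂∪I
     in restrict G V₁∪I , restrict G V₂∪I
      , R₁.restrict-orientation
      , R₁.restrict-quasiTransitive qt (side-triangleClosed B₂ (λ ()))
      , R₂.restrict-orientation
      , R₂.restrict-quasiTransitive qt (side-triangleClosed B₁ (λ ()))
      , λ v vI → restrict-sourceOrSink {G = G} (cut-vertex-sourceOrSink {G = G} po qt vI))
  (λ (G₁ , G₂ , po₁ , qt₁ , po₂ , qt₂ , ends) →
     let open Union {Γ = Γ} {G₁ = G₁} {G₂ = G₂} po₁ po₂ both-sides-independent
     in G
      , union-orientation adj⇒same-side
      , union-quasiTransitive qt₁ qt₂ (λ v₁ v₂ → ends _ (both-sides⇒BI v₁ v₂)))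
  where
  open Cut cut
  V₁∪I V₂∪I : VSet _
  V₁∪I x = part x ≢ B₂
  V₂∪I x = part x ≢ B₁
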